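{- Let $G$ be a bicritical graph that is not a brick. Then after any brick decomposition procedure of $G$, among the resulting bricks there are at least two bricks each of which has exactly one marker edge.
   Context: All graphs are finite and simple. A graph with at least four vertices is bicritical if deleting any two distinct vertices leaves a graph with a perfect matching. A brick is a 3-connected bicritical graph. A barrier of a graph $G$ with a perfect matching is a set $B\subseteq V(G)$ with $c_o(G-B)=|B|$, where $c_o$ denotes the number of odd components; a 2-separation of $G$ is a 2-vertex cut of $G$ that is not a barrier (in a bicritical graph every 2-vertex cut is a 2-separation). Decomposition step: if $\{u,v\}$ is a 2-vertex cut of a graph $H$, write $H=H_1'\cup H_2'$ with $H_1',H_2'$ edge-disjoint subgraphs, each with more than two vertices, and $V(H_1')\cap V(H_2')=\{u,v\}$; let $H_i=H_i'+uv$ if $uv\notin E(H_i')$ and $H_i=H_i'$ otherwise ($i=1,2$); the edge $uv$ is called a marker edge of $H_i$ for $i=1,2$. If $H$ is bicritical then so are $H_1,H_2$. When a graph $H_i$ carrying marker edges is further decomposed along a 2-vertex cut, each of its marker edges is a marker edge of whichever of the two resulting graphs contains it (of both if the cut is its own end-pair). A brick decomposition procedure of a bicritical graph $G$ repeatedly applies decomposition steps along 2-separations to the current non-3-connected bicritical graphs, starting from $G$, until all resulting graphs are bricks; these final graphs are the bricks of $G$, and the marker edges of a brick are those marker edges (created in any step) that it carries. -}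

module Defs where

open import Data.Nat using (ℕ; zero; suc; _+_; _<_; _≤_; _<ᵇ_)
open import Data.Fin using (Fin; toℕ) renaming (zero to fz; suc to fs)
open import Data.Fin.Properties using (_≟_)
open import Data.Bool using (Bool; true; false; _∧_; _∨_; not; if_then_else_)
open import Data.List using (List; []; _∷_; _++_; length; lookup)
open import Data.List.Relation.Unary.All using (All)
open import Data.Product using (Σ; _×_; _,_; ∃; ∃-syntax)
open import Relation.Binary.PropositionalEquality using (_≡_; _≢_)
open import Relation.Nullary using (¬_)
open import Relation.Nullary.Decidable using (⌊_⌋)
open import Relation.Binary.Construct.Closure.ReflexiveTransitive using (Star)

VSet : ℕ → Set
VSet n = Fin n → Bool

ERel : ℕ → Set
ERel n = Fin n → Fin n → Bool

count : ∀ {n} → VSet n → ℕ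
count {zero}  p = 0
count {suc n} p = (if p fz then 1 else 0) + count (λ i → p (fs i))

anyF : ∀ {n} → VSet n → Bool
anyF {zero}  p = false
anyF {suc n} p = p fz ∨ anyF (λ i → p (fs i))

allF : ∀ {n} → VSet n → Bool
allF {zero}  p = true
allF {suc n} p = p fz ∧ allF (λ i → p (fs i))

isOdd : ℕ → Bool
isOdd zero    = false
isOdd (suc k) = not (isOdd k)

_∖_ : ∀ {n} → VSet n → VSet n → VSet n
(T ∖ X) x = T x ∧ not (X x)

pair : ∀ {n} → Fin n → Fin n → VSet n
pair u v x = ⌊ x ≟ u ⌋ ∨ ⌊ x ≟ v ⌋

isPair : ∀ {n} → Fin n → Fin n → ERel n
isPair u v x y = (⌊ x ≟ u ⌋ ∧ ⌊ y ≟ v ⌋) ∨ (⌊ x ≟ v ⌋ ∧ ⌊ y ≟ u ⌋)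

record Graph (n : ℕ) : Set where
  field
    V : VSet n
    E : ERel n
open Graph public

IsGraph : ∀ {n} → Graph n → Set
IsGraph G = (∀ x y → E G x y ≡ E G y x)
          × (∀ x → E G x x ≡ false)
          × (∀ x y → E G x y ≡ true → V G x ≡ true)

-- Reachability inside the induced subgraph on T (paths of length ≤ k)

reachIn : ∀ {n} → VSet n → ERel n → ℕ → Fin n → Fin n → Bool
reachIn T E zero    x y = T x ∧ T y ∧ ⌊ x ≟ y ⌋
reachIn T E (suc k) x y =
  reachIn T E k x y ∨ anyF (λ z → reachIn T E k x z ∧ T y ∧ E z y)

reach : ∀ {n} → VSet n → ERel n → Fin n → Fin n → Bool
reach {n} T E = reachIn T E n

Connected : ∀ {n} → VSet n → ERel n → Set
Connected T E = ∀ x y → T x ≡ true → T y ≡ true → reach T E x y ≡ true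

-- number of odd components of the induced subgraph on T:
-- count components via their least vertex
oddComponents : ∀ {n} → VSet n → ERel n → ℕ
oddComponents T E =
  count (λ x → T x
             ∧ allF (λ y → not (reach T E x y ∧ (toℕ y <ᵇ toℕ x)))
             ∧ isOdd (count (reach T E x)))

HasPerfectMatching : ∀ {n} → VSet n → ERel n → Set
HasPerfectMatching {n} T E =
  Σ (ERel n) λ Mt →
      (∀ x y → Mt x y ≡ true → (E x y ≡ true) × (T x ≡ true) × (T y ≡ true))
    × (∀ x y → Mt x y ≡ Mt y x)
    × (∀ x → T x ≡ true → ∃[ y ] (Mt x y ≡ true × (∀ z → Mt x z ≡ true → z ≡ y)))

IsBicritical : ∀ {n} → Graph n → Set
IsBicritical G =
    (4 ≤ count (V G))
  × (∀ x y → V G x ≡ true → V G y ≡ true → x ≢ y →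
       HasPerfectMatching (V G ∖ pair x y) (E G))

ThreeConnected : ∀ {n} → Graph n → Set
ThreeConnected G =
  (3 < count (V G)) × (∀ X → count X < 3 → Connected (V G ∖ X) (E G))

IsBrick : ∀ {n} → Graph n → Set
IsBrick G = ThreeConnected G × IsBicritical G

TwoVertexCut : ∀ {n} → Graph n → Fin n → Fin n → Set
TwoVertexCut G u v =
  (u ≢ v) × (V G u ≡ true) × (V G v ≡ true)
  × ¬ Connected (V G ∖ pair u v) (E G)

IsBarrier : ∀ {n} → Graph n → VSet n → Set
IsBarrier G B = oddComponents (V G ∖ B) (E G) ≡ count B

TwoSeparation : ∀ {n} → Graph n → Fin n → Fin n → Set
TwoSeparation G u v = TwoVertexCut G u v × ¬ IsBarrier G (pair u v)

record Piece (n : ℕ) : Set where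
  field
    graph  : Graph n
    marker : ERel n
open Piece public

start : ∀ {n} → Graph n → Piece n
start G = record { graph = G ; marker = λ _ _ → false }

-- H_i = H_i' + uv, with marker edges: those of H lying in H_i, plus uv
glue : ∀ {n} → Piece n → Graph n → Fin n → Fin n → Piece n
glue H H' u v = record
  { graph  = record { V = V H' ; E = Ei }
  ; marker = λ x y → (marker H x y ∧ Ei x y) ∨ isPair u v x y }
  where
  Ei : ERel _
  Ei x y = E H' x y ∨ isPair u v x y

record SplitData {n} (H : Piece n) (H1' H2' : Graph n) (u v : Fin n) : Set where
  field
    bicritical : IsBicritical (graph H)
    twoSep     : TwoSeparation (graph H) u v
    graph₁     : IsGraph H1'
    graph₂     : IsGraph H2'
    vunion     : ∀ x → V (graph H) x ≡ (V H1' x ∨ V H2' x)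
    vinter     : ∀ x → (V H1' x ∧ V H2' x) ≡ pair u v x
    eunion     : ∀ x y → E (graph H) x y ≡ (E H1' x y ∨ E H2' x y)
    edisj      : ∀ x y → (E H1' x y ∧ E H2' x y) ≡ false
    big₁       : 2 < count (V H1')
    big₂       : 2 < count (V H2')

data DecompStep {n} : List (Piece n) → List (Piece n) → Set where
  step : ∀ (xs ys : List (Piece n)) (H : Piece n) (H1' H2' : Graph n) (u v : Fin n) →
         SplitData H H1' H2' u v →
         DecompStep (xs ++ H ∷ ys) (xs ++ glue H H1' u v ∷ glue H H2' u v ∷ ys)

Decomp : ∀ {n} → List (Piece n) → List (Piece n) → Set
Decomp = Star DecompStep

IsBrickPiece : ∀ {n} → Piece n → Set
IsBrickPiece H = IsBrick (graph H)

ExactlyOneMarker : ∀ {n} → Piece n → Set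
ExactlyOneMarker H =
  ∃[ u ] ∃[ v ] (marker H u v ≡ true
                × (∀ x y → marker H x y ≡ true → isPair u v x y ≡ true))

-- A piece with exactly one marker edge e passes that property on to at least one
-- of its two parts: e is an edge of exactly one of the edge-disjoint halves, so
-- the other half carries only the new marker.  The first step splits the
-- marker-free G into two pieces with one marker each, and from then on no step
-- can decrease the number of pieces with exactly one marker.  Since G is not a
-- brick, the procedure takes at least one step.
module Submission where

open import Defs
open import Data.Nat using (ℕ; suc)
open import Data.Fin using (Fin) renaming (zero to fz; suc to fs)
open import Data.Fin.Properties using (_≟_; suc-injective)
open import Data.Bool using (Bool; true; false; _∧_; _∨_)
open import Data.Bool.Properties using (∨-zeroʳ; ∧-comm)
open import Data.List using (List; []; _∷_; _++_; lookup)
open import Data.List.Relation.Unary.All using (All; []; _∷_)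
open import Data.List.Relation.Unary.All.Properties using (++⁺; ++⁻)
open import Data.Product using (_×_; _,_; ∃-syntax; proj₁; proj₂)
open import Data.Sum using (_⊎_; inj₁; inj₂; [_,_]′)
open import Data.Empty using (⊥-elim)
open import Function using (_∘_; id)
open import Relation.Binary.PropositionalEquality using (_≡_; _≢_; refl; sym; trans)
open import Relation.Binary.Construct.Closure.ReflexiveTransitive using (fold)
open import Relation.Nullary using (¬_; yes)
open import Relation.Nullary.Decidable using (⌊_⌋; isYes≗does; dec-true)

∨-true⁻ : ∀ {a b : Bool} → (a ∨ b) ≡ true → a ≡ true ⊎ b ≡ true
∨-true⁻ {true}  _ = inj₁ refl
∨-true⁻ {false} p = inj₂ p

∧-true⁻ : ∀ {a b : Bool} → (a ∧ b) ≡ true → a ≡ true × b ≡ true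
∧-true⁻ {true} {true} _ = refl , refl

∧-false-left-true : ∀ {a b : Bool} → a ≡ true → (a ∧ b) ≡ false → b ≡ false
∧-false-left-true refl p = p

≟-sound : ∀ {n} {x y : Fin n} → ⌊ x ≟ y ⌋ ≡ true → x ≡ y
≟-sound {x = x} {y} p with x ≟ y
... | yes x≡y = x≡y

≟-refl : ∀ {n} (x : Fin n) → ⌊ x ≟ x ⌋ ≡ true
≟-refl x = trans (isYes≗does (x ≟ x)) (dec-true (x ≟ x) refl)

isPair-refl : ∀ {n} (u v : Fin n) → isPair u v u v ≡ true
isPair-refl u v rewrite ≟-refl u | ≟-refl v = refl

isPair-sound : ∀ {n} {u v x y : Fin n} → isPair u v x y ≡ true →
               (x ≡ u × y ≡ v) ⊎ (x ≡ v × y ≡ u)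
isPair-sound p with ∨-true⁻ p
... | inj₁ q with ∧-true⁻ q
...   | x≟u , y≟v = inj₁ (≟-sound x≟u , ≟-sound y≟v)
isPair-sound p | inj₂ q with ∧-true⁻ q
...   | x≟v , y≟u = inj₂ (≟-sound x≟v , ≟-sound y≟u)

module _ {n : ℕ} where

  MarkersAreEdges : Piece n → Set
  MarkersAreEdges H = ∀ x y → marker H x y ≡ true → E (graph H) x y ≡ true

  glue-markersAreEdges : ∀ H H' (u v : Fin n) → MarkersAreEdges (glue H H' u v)
  glue-markersAreEdges H H' u v x y p with ∨-true⁻ {a = marker H x y ∧ _} p
  ... | inj₁ q = proj₂ (∧-true⁻ {a = marker H x y} q)
  ... | inj₂ q rewrite q = ∨-zeroʳ (E H' x y)

  glue-exactlyOneMarker : ∀ H H' (u v : Fin n) →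
                          (∀ x y → marker H x y ≡ true → E H' x y ≡ false) →
                          ExactlyOneMarker (glue H H' u v)
  glue-exactlyOneMarker H H' u v oldMarkersOutside = u , v , uv-marker , only-uv
    where
    uv-marker : marker (glue H H' u v) u v ≡ true
    uv-marker rewrite isPair-refl u v = ∨-zeroʳ _

    only-uv : ∀ x y → marker (glue H H' u v) x y ≡ true → isPair u v x y ≡ true
    only-uv x y p with ∨-true⁻ {a = marker H x y ∧ _} p
    ... | inj₂ q = q
    ... | inj₁ q with ∧-true⁻ {a = marker H x y} q
    ...   | old , inH' rewrite oldMarkersOutside x y old = inH'

  onlyMarker-notEdge : ∀ H (E' : ERel n) {u₀ v₀ : Fin n} →
                       (∀ x y → E' x y ≡ E' y x) →
                       (∀ x y → marker H x y ≡ true → isPair u₀ v₀ x y ≡ true) →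
                       E' u₀ v₀ ≡ false →
                       ∀ x y → marker H x y ≡ true → E' x y ≡ false
  onlyMarker-notEdge H E' {u₀} {v₀} sym-E' only e x y m
    with isPair-sound {u = u₀} {v = v₀} {x = x} {y = y} (only x y m)
  ... | inj₁ (refl , refl) = e
  ... | inj₂ (refl , refl) = trans (sym-E' x y) e

  split-exactlyOneMarker : ∀ {H H₁' H₂'} {u v : Fin n} → SplitData H H₁' H₂' u v →
                           MarkersAreEdges H → ExactlyOneMarker H →
                           ExactlyOneMarker (glue H H₁' u v) ⊎ ExactlyOneMarker (glue H H₂' u v)
  split-exactlyOneMarker {H} {H₁'} {H₂'} {u} {v} sd edges (u₀ , v₀ , m₀ , only) =
    [ inj₂ ∘ part₂-exactlyOneMarker , inj₁ ∘ part₁-exactlyOneMarker ]′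
      (∨-true⁻ (trans (sym (eunion u₀ v₀)) (edges u₀ v₀ m₀)))
    where
    open SplitData sd

    part₂-exactlyOneMarker : E H₁' u₀ v₀ ≡ true → ExactlyOneMarker (glue H H₂' u v)
    part₂-exactlyOneMarker in₁ = glue-exactlyOneMarker H H₂' u v
      (onlyMarker-notEdge H (E H₂') (proj₁ graph₂) only
        (∧-false-left-true in₁ (edisj u₀ v₀)))

    part₁-exactlyOneMarker : E H₂' u₀ v₀ ≡ true → ExactlyOneMarker (glue H H₁' u v)
    part₁-exactlyOneMarker in₂ = glue-exactlyOneMarker H H₁' u v
      (onlyMarker-notEdge H (E H₁') (proj₁ graph₁) only
        (∧-false-left-true in₂ (trans (∧-comm (E H₂' u₀ v₀) _) (edisj u₀ v₀))))

data AtLeast {A : Set} (P : A → Set) : ℕ → List A → Set where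
  []    : ∀ {xs} → AtLeast P 0 xs
  _∷_   : ∀ {k x xs} → P x → AtLeast P k xs → AtLeast P (suc k) (x ∷ xs)
  skip  : ∀ {k x xs} → AtLeast P k xs → AtLeast P k (x ∷ xs)

atLeast-replace : ∀ {A : Set} {P : A → Set} {k} (xs : List A) {ys} {x y z : A} →
                  (P x → P y ⊎ P z) →
                  AtLeast P k (xs ++ x ∷ ys) → AtLeast P k (xs ++ y ∷ z ∷ ys)
atLeast-replace []       f []           = []
atLeast-replace []       f (px ∷ rest) with f px
... | inj₁ py = py ∷ skip rest
... | inj₂ pz = skip (pz ∷ rest)
atLeast-replace []       f (skip rest)  = skip (skip rest)
atLeast-replace (_ ∷ xs) f []           = []
atLeast-replace (_ ∷ xs) f (pw ∷ rest)  = pw ∷ atLeast-replace xs f rest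
atLeast-replace (_ ∷ xs) f (skip rest)  = skip (atLeast-replace xs f rest)

atLeast-one-index : ∀ {A : Set} {P : A → Set} {k} {xs : List A} →
                    AtLeast P (suc k) xs → ∃[ i ] P (lookup xs i)
atLeast-one-index (px ∷ _)    = fz , px
atLeast-one-index (skip rest) with atLeast-one-index rest
... | i , pi = fs i , pi

atLeast-two-indices : ∀ {A : Set} {P : A → Set} {xs : List A} → AtLeast P 2 xs →
                      ∃[ i ] ∃[ j ] (i ≢ j × P (lookup xs i) × P (lookup xs j))
atLeast-two-indices (px ∷ rest) with atLeast-one-index rest
... | j , pj = fz , fs j , (λ ()) , px , pj
atLeast-two-indices (skip rest) with atLeast-two-indices rest
... | i , j , i≢j , pi , pj = fs i , fs j , i≢j ∘ suc-injective , pi , pj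

module _ {n : ℕ} (G : Graph n) where

  DecompInvariant : List (Piece n) → Set
  DecompInvariant L = All MarkersAreEdges L
                    × (L ≡ start G ∷ [] ⊎ AtLeast ExactlyOneMarker 2 L)

  firstStep-twoSingleMarkers : ∀ (xs ys : List (Piece n)) H H₁' H₂' (u v : Fin n) →
                               xs ++ H ∷ ys ≡ start G ∷ [] →
                               AtLeast ExactlyOneMarker 2 (xs ++ glue H H₁' u v ∷ glue H H₂' u v ∷ ys)
  firstStep-twoSingleMarkers [] [] _ H₁' H₂' u v refl =
    glue-exactlyOneMarker (start G) H₁' u v (λ _ _ ()) ∷
    glue-exactlyOneMarker (start G) H₂' u v (λ _ _ ()) ∷ []
  firstStep-twoSingleMarkers (_ ∷ [])    _ _ _ _ _ _ ()
  firstStep-twoSingleMarkers (_ ∷ _ ∷ _) _ _ _ _ _ _ ()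

  decompStep-invariant : ∀ {L M} → DecompStep L M → DecompInvariant L → DecompInvariant M
  decompStep-invariant (step xs ys H H₁' H₂' u v sd) (edges , singles)
    with ++⁻ xs edges
  ... | edges-xs , edges-H ∷ edges-ys =
    ++⁺ edges-xs (glue-markersAreEdges H H₁' u v ∷ glue-markersAreEdges H H₂' u v ∷ edges-ys) ,
    inj₂ (twoSingleMarkers singles)
    where
    twoSingleMarkers : (xs ++ H ∷ ys) ≡ start G ∷ [] ⊎ AtLeast ExactlyOneMarker 2 (xs ++ H ∷ ys) →
                       AtLeast ExactlyOneMarker 2 (xs ++ glue H H₁' u v ∷ glue H H₂' u v ∷ ys)
    twoSingleMarkers (inj₁ first) = firstStep-twoSingleMarkers xs ys H H₁' H₂' u v first
    twoSingleMarkers (inj₂ two)   = atLeast-replace xs (split-exactlyOneMarker sd edges-H) two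

  decomp-invariant : ∀ {L} → Decomp (start G ∷ []) L → DecompInvariant L
  decomp-invariant d =
    fold (λ L M → DecompInvariant L → DecompInvariant M)
         (λ s rest → rest ∘ decompStep-invariant s) id d
         ((λ _ _ ()) ∷ [] , inj₁ refl)

lemma2p3 : ∀ {n} (G : Graph n) → IsGraph G → IsBicritical G → ¬ IsBrick G →
           ∀ (L : List (Piece n)) → Decomp (start G ∷ []) L → All IsBrickPiece L →
           ∃[ i ] ∃[ j ] (i ≢ j × ExactlyOneMarker (lookup L i) × ExactlyOneMarker (lookup L j))
lemma2p3 G _ _ notBrick L d bricks with decomp-invariant G d
... | _ , inj₂ two = atLeast-two-indices two
... | _ , inj₁ refl with bricks
...   | brick ∷ [] = ⊥-elim (notBrick brick)
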